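{- Let $G$ be a graph with at least $7$ vertices. Then $F(G)\geq 3$.
   Context: All graphs are finite and simple. Given a graph $G$ and a set $S\subseteq V(G)$ of vertices (called blue; the others are white), the forcing rule is: if a vertex $v\in S$ has exactly one neighbor $u$ not in $S$, then $u$ is added to $S$. A set $S$ is a failed zero-forcing set of $G$ if repeated application of the forcing rule starting from $S$ does not result in all vertices of $G$ being in $S$. The failed zero-forcing number $F(G)$ is the maximum cardinality of a failed zero-forcing set of $G$ (the empty set counts as a set of cardinality $0$). -}

module Defs where

open import Data.Nat using (ℕ)
open import Data.Fin using (Fin)
open import Data.Fin.Subset using (Subset; _∈_; ∣_∣)
open import Data.Product using (∃-syntax; _×_)
open import Data.Nat using (_≤_)
open import Relation.Nullary using (¬_; Dec)
open import Relation.Binary.PropositionalEquality using (_≡_; _≢_)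
open import Level using (0ℓ)

record Graph (n : ℕ) : Set₁ where
  field
    Adj      : Fin n → Fin n → Set
    adj?     : ∀ u v → Dec (Adj u v)
    sym      : ∀ {u v} → Adj u v → Adj v u
    irrefl   : ∀ {u} → ¬ Adj u u
open Graph public

-- The set of vertices eventually coloured blue when the forcing rule is
-- applied repeatedly starting from S (least set containing S and closed
-- under the forcing rule).
data Blue {n : ℕ} (G : Graph n) (S : Subset n) : Fin n → Set where
  initial : ∀ {v} → v ∈ S → Blue G S v
  force   : ∀ {v u} → Blue G S v → Adj G v u →
            (∀ w → Adj G v w → w ≢ u → Blue G S w) → Blue G S u

FailedZF : ∀ {n} → Graph n → Subset n → Set
FailedZF {n} G S = ∃[ u ] ¬ Blue G S u

-- F(G) ≥ k : there is a failed zero-forcing set of cardinality at least k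
-- (F(G) is the maximum size of a failed zero-forcing set).
FailedZFNumber≥ : ∀ {n} → Graph n → ℕ → Set
FailedZFNumber≥ {n} G k = ∃[ S ] (k ≤ ∣ S ∣ × FailedZF G S)

{-# OPTIONS --safe #-}
-- A set S is failed as soon as it is stalled (every vertex of S has no neighbour outside S or at
-- least two) and misses some vertex. Dually, if every vertex outside a nonempty set W has no
-- neighbour or at least two neighbours in W, the complement of W is failed. With seven vertices
-- there is always room for one of the two: a set W of at most two vertices (an isolated vertex,
-- an isolated edge, two leaves on a common neighbour) or a stalled set of three or four vertices.
-- The search is a case analysis on the degree of one vertex. A vertex of degree at least four
-- never forces inside a three-element set; in the other cases further vertices are probed one at
-- a time, and each is isolated, a leaf, or has two neighbours away from what has been built.
module Submission where

open import Defs hiding (sym)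
open import Data.Nat using (ℕ; suc; _+_; _≤_; _<_; s≤s; z≤n)
open import Data.Nat.Properties using (≤-trans; +-mono-≤; _≤?_; _<?_)
open import Data.Fin using (Fin; _≟_; fromℕ<)
open import Data.Fin.Properties using (all?; any?; ¬∀⟶∃¬; pigeonhole; <⇒≢)
import Data.Fin.Subset as Subset
open import Data.Fin.Subset using (Subset; ∣_∣)
open import Data.Fin.Subset.Properties using (x∈p⇒∣p-x∣<∣p∣; x∈p∧x≢y⇒x∈p-y)
open import Data.Vec using (tabulate)
open import Data.Vec.Properties using (lookup∘tabulate; lookup⇒[]=; []=⇒lookup)
open import Data.List using (List; []; _∷_; length; lookup)
open import Data.List.Relation.Unary.Any using (here; there; index)
open import Data.List.Relation.Unary.Any.Properties using (lookup-index)
open import Data.List.Relation.Unary.All as All using (All; []; _∷_)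
open import Data.List.Relation.Unary.All.Properties using (¬Any⇒All¬; All¬⇒¬Any)
open import Data.List.Relation.Unary.Unique.Propositional using (Unique; []; _∷_)
open import Data.List.Membership.Propositional using (_∈_)
import Data.List.Membership.DecPropositional as DecMembership
open import Data.Product using (∃; ∃₂; _×_; _,_; proj₁)
open import Data.Sum using (_⊎_; inj₁; inj₂)
open import Data.Empty using (⊥-elim)
open import Function using (_∘_; id)
open import Level using (0ℓ)
open import Relation.Nullary using (¬_; yes; no; does; ¬?)
open import Relation.Nullary.Decidable using (True; toWitness; decidable-stable; _×-dec_)
open import Relation.Unary using (Pred; Decidable)
open import Relation.Binary.PropositionalEquality using (_≡_; _≢_; refl; sym; trans; cong; ≢-sym)

variable
  m : ℕ

Two : Pred (Fin m) 0ℓ → Set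
Two P = ∃₂ λ u w → u ≢ w × P u × P w

Three : Pred (Fin m) 0ℓ → Set
Three P = ∃₂ λ u v → ∃ λ w → (u ≢ v × u ≢ w × v ≢ w) × P u × P v × P w

Four : Pred (Fin m) 0ℓ → Set
Four P = ∃₂ λ u v → ∃₂ λ w t → (u ≢ v × u ≢ w × u ≢ t × v ≢ w × v ≢ t × w ≢ t) × P u × P v × P w × P t

module _ {P Q : Pred (Fin m) 0ℓ} where

  Two-map : (∀ {u} → P u → Q u) → Two P → Two Q
  Two-map f (u , w , u≢w , pu , pw) = u , w , u≢w , f pu , f pw

module _ {P : Pred (Fin m) 0ℓ} where

  three⇒two≢ : Three P → ∀ x → Two (λ c → P c × c ≢ x)
  three⇒two≢ (c₁ , c₂ , c₃ , (c₁≢c₂ , c₁≢c₃ , c₂≢c₃) , p₁ , p₂ , p₃) x with c₁ ≟ x | c₂ ≟ x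
  ... | yes refl | yes refl = ⊥-elim (c₁≢c₂ refl)
  ... | yes refl | no c₂≢x  = c₂ , c₃ , c₂≢c₃ , (p₂ , c₂≢x) , (p₃ , ≢-sym c₁≢c₃)
  ... | no c₁≢x  | yes refl = c₁ , c₃ , c₁≢c₃ , (p₁ , c₁≢x) , (p₃ , ≢-sym c₂≢c₃)
  ... | no c₁≢x  | no c₂≢x  = c₁ , c₂ , c₁≢c₂ , (p₁ , c₁≢x) , (p₂ , c₂≢x)

  four⇒three≢ : Four P → ∀ x → Three (λ c → P c × c ≢ x)
  four⇒three≢ (c₁ , c₂ , c₃ , c₄ , (d₁₂ , d₁₃ , d₁₄ , d₂₃ , d₂₄ , d₃₄) , p₁ , p₂ , p₃ , p₄) x
    with c₁ ≟ x | c₂ ≟ x | c₃ ≟ x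
  ... | yes refl | _ | _ =
    c₂ , c₃ , c₄ , (d₂₃ , d₂₄ , d₃₄) , (p₂ , ≢-sym d₁₂) , (p₃ , ≢-sym d₁₃) , (p₄ , ≢-sym d₁₄)
  ... | no c₁≢x | yes refl | _ =
    c₁ , c₃ , c₄ , (d₁₃ , d₁₄ , d₃₄) , (p₁ , c₁≢x) , (p₃ , ≢-sym d₂₃) , (p₄ , ≢-sym d₂₄)
  ... | no c₁≢x | no c₂≢x | yes refl =
    c₁ , c₂ , c₄ , (d₁₂ , d₁₄ , d₂₄) , (p₁ , c₁≢x) , (p₂ , c₂≢x) , (p₄ , ≢-sym d₃₄)
  ... | no c₁≢x | no c₂≢x | no c₃≢x =
    c₁ , c₂ , c₃ , (d₁₂ , d₁₃ , d₂₃) , (p₁ , c₁≢x) , (p₂ , c₂≢x) , (p₃ , c₃≢x)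

four⇒two∉ : {P : Pred (Fin m) 0ℓ} → Four P → ∀ x y → Two (λ c → P c × All (c ≢_) (x ∷ y ∷ []))
four⇒two∉ four x y =
  Two-map (λ ((pc , c≢x) , c≢y) → pc , c≢x ∷ c≢y ∷ []) (three⇒two≢ (four⇒three≢ four x) y)

subset : {P : Pred (Fin m) 0ℓ} → Decidable P → Subset m
subset P? = tabulate (does ∘ P?)

module _ {P : Pred (Fin m) 0ℓ} (P? : Decidable P) {x : Fin m} where

  ∈subset⁺ : P x → x Subset.∈ subset P?
  ∈subset⁺ px with P? x in eq
  ... | yes _ = lookup⇒[]= x (subset P?) (trans (lookup∘tabulate (does ∘ P?) x) (cong does eq))
  ... | no ¬px = ⊥-elim (¬px px)

  ∈subset⁻ : x Subset.∈ subset P? → P x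
  ∈subset⁻ x∈S with P? x in eq
  ... | yes px = px
  ... | no _ with () ← trans (sym (cong does eq)) (trans (sym (lookup∘tabulate (does ∘ P?) x)) ([]=⇒lookup x∈S))

unique⇒length≤∣∣ : {S : Subset m} {L : List (Fin m)} → Unique L → All (Subset._∈ S) L → length L ≤ ∣ S ∣
unique⇒length≤∣∣ [] [] = z≤n
unique⇒length≤∣∣ (x∉xs ∷ unique) (x∈S ∷ xs⊆S) =
  ≤-trans (s≤s (unique⇒length≤∣∣ unique (All.zipWith (λ (y∈S , x≢y) → x∈p∧x≢y⇒x∈p-y y∈S (≢-sym x≢y))
                                                      (xs⊆S , x∉xs))))
          (x∈p⇒∣p-x∣<∣p∣ x∈S)

module _ {m : ℕ} where
  open DecMembership (_≟_ {m}) using (_∈?_)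

  length<n⇒∃∉ : (L : List (Fin m)) → length L < m → ∃ λ y → All (y ≢_) L
  length<n⇒∃∉ L len<m with all? (_∈? L)
  ... | no ¬all = let y , y∉L = ¬∀⟶∃¬ _ _ (_∈? L) ¬all in y , ¬Any⇒All¬ L y∉L
  ... | yes all∈ with pigeonhole len<m (index ∘ all∈)
  ...   | i , j , i<j , same =
    ⊥-elim (<⇒≢ i<j (trans (lookup-index (all∈ i)) (trans (cong (lookup L) same) (sym (lookup-index (all∈ j))))))

module _ {n : ℕ} (G : Graph n) where

  CannotForce : Pred (Fin n) 0ℓ → Fin n → Set
  CannotForce P x = (∀ {u} → Adj G x u → P u) ⊎ Two (λ u → Adj G x u × ¬ P u)

  Stalled : Pred (Fin n) 0ℓ → Set
  Stalled P = ∀ {x} → P x → CannotForce P x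

  module _ {P : Pred (Fin n) 0ℓ} (P? : Decidable P) (stalled : Stalled P) where

    Blue⇒ : ∀ {x} → Blue G (subset P?) x → P x
    Blue⇒ (initial x∈S) = ∈subset⁻ P? x∈S
    Blue⇒ (force {v} {u} v-blue v~u others) with stalled (Blue⇒ v-blue)
    ... | inj₁ all-blue = all-blue v~u
    ... | inj₂ (w₁ , w₂ , w₁≢w₂ , (v~w₁ , ¬Pw₁) , (v~w₂ , ¬Pw₂)) with w₁ ≟ u
    ...   | no w₁≢u = ⊥-elim (¬Pw₁ (Blue⇒ (others w₁ v~w₁ w₁≢u)))
    ...   | yes refl = ⊥-elim (¬Pw₂ (Blue⇒ (others w₂ v~w₂ (w₁≢w₂ ∘ sym))))

    stalled⇒F≥ : {L : List (Fin n)} {z : Fin n} → Unique L → All P L → ¬ P z → FailedZFNumber≥ G (length L)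
    stalled⇒F≥ unique L⊆P ¬Pz =
      subset P? , unique⇒length≤∣∣ unique (All.map (∈subset⁺ P?) L⊆P) , _ , ¬Pz ∘ Blue⇒

  F≥-mono : ∀ {k k′} → k ≤ k′ → FailedZFNumber≥ G k′ → FailedZFNumber≥ G k
  F≥-mono k≤k′ (S , k′≤∣S∣ , failed) = S , ≤-trans k≤k′ k′≤∣S∣ , failed

module Casework {n : ℕ} (G : Graph n) (7≤n : 7 ≤ n) where

  open DecMembership (_≟_ {n}) using (_∈?_)

  infix 4 _~_ _∉_

  V : Set
  V = Fin n

  _~_ : V → V → Set
  _~_ = Adj G

  _∉_ : V → List V → Set
  x ∉ L = All (x ≢_) L

  Nbrs⊆ : V → List V → Set
  Nbrs⊆ x L = ∀ {u} → x ~ u → u ∈ L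

  TwoNbrsOutside : V → List V → Set
  TwoNbrsOutside x E = Two (λ t → x ~ t × t ∉ E)

  LeafAt : V → V → Set
  LeafAt t y = y ~ t × Nbrs⊆ y (t ∷ [])

  CannotForceIn : List V → V → Set
  CannotForceIn L = CannotForce G (_∈ L)

  F≥3 : Set
  F≥3 = FailedZFNumber≥ G 3

  variable
    a b₁ b₂ b₃ l p q t t₁ t₂ t₃ u v w₁ w₂ w₃ w₄ x y y₁ y₂ y₃ z : V
    L : List V

  pattern 1st = here refl
  pattern 2nd = there 1st
  pattern 3rd = there 2nd
  pattern 4th = there 3rd

  ~-sym : x ~ y → y ~ x
  ~-sym = Graph.sym G

  ~⇒≢ : x ~ y → x ≢ y
  ~⇒≢ x~y refl = irrefl G x~y

  ∈⇒¬∉ : x ∈ L → ¬ x ∉ L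
  ∈⇒¬∉ x∈L x∉L = All¬⇒¬Any x∉L x∈L

  ¬nbr : Nbrs⊆ x L → y ∉ L → ¬ x ~ y
  ¬nbr nbx y∉L x~y = ∈⇒¬∉ (nbx x~y) y∉L

  nbr≢ : Nbrs⊆ x L → y ∉ L → y ~ t → t ≢ x
  nbr≢ nbx y∉L y~t refl = ¬nbr nbx y∉L (~-sym y~t)

  -- The hypothesis 7 ≤ n is used only here: no step excludes more than six vertices.
  fresh′ : (L : List V) → length L < 7 → ∃ (_∉ L)
  fresh′ L short = length<n⇒∃∉ L (≤-trans short 7≤n)

  fresh : (L : List V) → {True (length L <? 7)} → ∃ (_∉ L)
  fresh L {short} = fresh′ L (toWitness short)

  room : length L ≤ 2 → ∀ k → {True (k ≤? 4)} → k + length L < 7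
  room short k {k≤4} = s≤s (+-mono-≤ (toWitness k≤4) short)

  nbrOutside? : ∀ x E → (∃ λ t → x ~ t × t ∉ E) ⊎ Nbrs⊆ x E
  nbrOutside? x E with any? (λ t → adj? G x t ×-dec ¬? (t ∈? E))
  ... | yes (t , x~t , t∉E) = inj₁ (t , x~t , ¬Any⇒All¬ E t∉E)
  ... | no ∄ = inj₂ λ {t} x~t → decidable-stable (t ∈? E) (λ t∉E → ∄ (t , x~t , t∉E))

  data NbrsOutside (x : V) (E : List V) : Set where
    none : Nbrs⊆ x E → NbrsOutside x E
    one  : ∀ t → t ∉ E → x ~ t → Nbrs⊆ x (t ∷ E) → NbrsOutside x E
    two+ : TwoNbrsOutside x E → NbrsOutside x E

  nbrsOutside : ∀ x E → NbrsOutside x E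
  nbrsOutside x E with nbrOutside? x E
  ... | inj₂ nbx = none nbx
  ... | inj₁ (t₁ , x~t₁ , t₁∉E) with nbrOutside? x (t₁ ∷ E)
  ...   | inj₂ nbx = one t₁ t₁∉E x~t₁ nbx
  ...   | inj₁ (t₂ , x~t₂ , t₂≢t₁ ∷ t₂∉E) = two+ (t₁ , t₂ , ≢-sym t₂≢t₁ , (x~t₁ , t₁∉E) , (x~t₂ , t₂∉E))

  data NbrsOutside⁺ (x : V) (E : List V) : Set where
    none   : Nbrs⊆ x E → NbrsOutside⁺ x E
    one    : ∀ t → t ∉ E → x ~ t → Nbrs⊆ x (t ∷ E) → NbrsOutside⁺ x E
    two    : ∀ t₁ t₂ → t₁ ≢ t₂ → t₁ ∉ E → t₂ ∉ E → x ~ t₁ → x ~ t₂ → Nbrs⊆ x (t₁ ∷ t₂ ∷ E) →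
             NbrsOutside⁺ x E
    three+ : Three (λ t → x ~ t × t ∉ E) → NbrsOutside⁺ x E

  nbrsOutside⁺ : ∀ x E → NbrsOutside⁺ x E
  nbrsOutside⁺ x E with nbrsOutside x E
  ... | none nbx = none nbx
  ... | one t t∉E x~t nbx = one t t∉E x~t nbx
  ... | two+ (t₁ , t₂ , t₁≢t₂ , (x~t₁ , t₁∉E) , (x~t₂ , t₂∉E)) with nbrOutside? x (t₁ ∷ t₂ ∷ E)
  ...   | inj₂ nbx = two t₁ t₂ t₁≢t₂ t₁∉E t₂∉E x~t₁ x~t₂ nbx
  ...   | inj₁ (t₃ , x~t₃ , t₃≢t₁ ∷ t₃≢t₂ ∷ t₃∉E) =
    three+ (t₁ , t₂ , t₃ , (t₁≢t₂ , ≢-sym t₃≢t₁ , ≢-sym t₃≢t₂) , (x~t₁ , t₁∉E) , (x~t₂ , t₂∉E) , (x~t₃ , t₃∉E))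

  allNbrsIn : ∀ {M} → Nbrs⊆ x M → All (_∈ L) M → CannotForceIn L x
  allNbrsIn nbx M⊆L = inj₁ λ x~u → All.lookup M⊆L (nbx x~u)

  twoNbrsOut : TwoNbrsOutside x L → CannotForceIn L x
  twoNbrsOut = inj₂ ∘ Two-map λ (x~u , u∉L) → x~u , All¬⇒¬Any u∉L

  blueList : (L : List V) → {True (length L <? 7)} → Unique L → All (CannotForceIn L) L →
             FailedZFNumber≥ G (length L)
  blueList L {short} unique cannotForce with fresh L {short}
  ... | z , z∉L =
    stalled⇒F≥ G (_∈? L) (All.lookup cannotForce) unique (All.tabulate id) (λ z∈L → ∈⇒¬∉ z∈L z∉L)

  triple : ∀ a b c → a ≢ b → a ≢ c → b ≢ c → let T = a ∷ b ∷ c ∷ [] in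
           CannotForceIn T a → CannotForceIn T b → CannotForceIn T c → F≥3
  triple a b c a≢b a≢c b≢c cfa cfb cfc =
    blueList (a ∷ b ∷ c ∷ []) ((a≢b ∷ a≢c ∷ []) ∷ (b≢c ∷ []) ∷ [] ∷ []) (cfa ∷ cfb ∷ cfc ∷ [])

  quadruple : ∀ a b c d → a ≢ b → a ≢ c → a ≢ d → b ≢ c → b ≢ d → c ≢ d → let T = a ∷ b ∷ c ∷ d ∷ [] in
              CannotForceIn T a → CannotForceIn T b → CannotForceIn T c → CannotForceIn T d → F≥3
  quadruple a b c d a≢b a≢c a≢d b≢c b≢d c≢d cfa cfb cfc cfd =
    F≥-mono G (s≤s (s≤s (s≤s z≤n)))
      (blueList (a ∷ b ∷ c ∷ d ∷ [])
                ((a≢b ∷ a≢c ∷ a≢d ∷ []) ∷ (b≢c ∷ b≢d ∷ []) ∷ (c≢d ∷ []) ∷ [] ∷ [])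
                (cfa ∷ cfb ∷ cfc ∷ cfd ∷ []))

  -- W is a fort: no vertex outside W has exactly one neighbour in W.
  Fort : List V → Set
  Fort W = Stalled G (_∉ W)

  fort : (W : List V) → length W ≤ 2 → x ∈ W → Fort W → F≥3
  fort W short x∈W fortW with fresh′ W (room {L = W} short 0)
  ... | a , a∉W with fresh′ (a ∷ W) (room {L = W} short 1)
  ... | b , b≢a ∷ b∉W with fresh′ (b ∷ a ∷ W) (room {L = W} short 2)
  ... | c , c≢b ∷ c≢a ∷ c∉W =
    stalled⇒F≥ G (λ y → All.all? (λ w → ¬? (y ≟ w)) W) fortW
      ((≢-sym b≢a ∷ ≢-sym c≢a ∷ []) ∷ (≢-sym c≢b ∷ []) ∷ [] ∷ []) (a∉W ∷ b∉W ∷ c∉W ∷ []) (∈⇒¬∉ x∈W)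

  isolated : Nbrs⊆ u [] → F≥3
  isolated nbu = fort (_ ∷ []) (s≤s z≤n) 1st λ _ → inj₁ λ x~w → nbr≢ nbu [] x~w ∷ []

  isolatedEdge : Nbrs⊆ l (p ∷ []) → Nbrs⊆ p (l ∷ []) → F≥3
  isolatedEdge nbl nbp = fort (_ ∷ _ ∷ []) (s≤s (s≤s z≤n)) 1st
    λ { (x≢l ∷ x≢p ∷ []) → inj₁ λ x~w → nbr≢ nbl (x≢p ∷ []) x~w ∷ nbr≢ nbp (x≢l ∷ []) x~w ∷ [] }

  twinLeaves : ∀ {y₁ y₂} → y₁ ≢ y₂ → LeafAt t y₁ → LeafAt t y₂ → F≥3
  twinLeaves {t} {y₁} {y₂} y₁≢y₂ (y₁~t , nb₁) (y₂~t , nb₂) =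
    fort (y₁ ∷ y₂ ∷ []) (s≤s (s≤s z≤n)) 1st fortTwins
    where
    fortTwins : Fort (y₁ ∷ y₂ ∷ [])
    fortTwins {x} _ with x ≟ t
    ... | yes refl = inj₂ (y₁ , y₂ , y₁≢y₂ , (~-sym y₁~t , ∈⇒¬∉ 1st) , (~-sym y₂~t , ∈⇒¬∉ 2nd))
    ... | no x≢t = inj₁ λ x~w → nbr≢ nb₁ (x≢t ∷ []) x~w ∷ nbr≢ nb₂ (x≢t ∷ []) x~w ∷ []

  -- If two of four candidates are nonadjacent they form a stalled triple with a; otherwise w₃ and w₄
  -- are two white neighbours of both w₁ and w₂.
  module FourCandidates (a : V) (Avoid : List V) (short : length Avoid ≤ 2)
      (a-cannotForce : ∀ {x y} → x ∉ Avoid → y ∉ Avoid → CannotForceIn (a ∷ x ∷ y ∷ []) a)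
      (candidate : ∀ {x} → x ∉ a ∷ Avoid → (TwoNbrsOutside x (a ∷ []) → F≥3) → F≥3) where

    Candidate : V → Set
    Candidate x = x ∉ a ∷ Avoid × TwoNbrsOutside x (a ∷ [])

    nonadjacent : Candidate x → Candidate y → x ≢ y → ¬ x ~ y → F≥3
    nonadjacent {x} {y} (x≢a ∷ x∉Avoid , X) (y≢a ∷ y∉Avoid , Y) x≢y ¬x~y =
      triple a x y (≢-sym x≢a) (≢-sym y≢a) x≢y (a-cannotForce x∉Avoid y∉Avoid)
        (twoNbrsOut (Two-map (λ { (x~u , u≢a ∷ []) →
          x~u , u≢a ∷ ≢-sym (~⇒≢ x~u) ∷ (λ { refl → ¬x~y x~u }) ∷ [] }) X))
        (twoNbrsOut (Two-map (λ { (y~u , u≢a ∷ []) →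
          y~u , u≢a ∷ (λ { refl → ¬x~y (~-sym y~u) }) ∷ ≢-sym (~⇒≢ y~u) ∷ [] }) Y))

    fourCandidates : Candidate w₁ → Candidate w₂ → Candidate w₃ → Candidate w₄ →
                     w₂ ≢ w₁ → w₃ ≢ w₁ → w₃ ≢ w₂ → w₄ ≢ w₁ → w₄ ≢ w₂ → w₄ ≢ w₃ → F≥3
    fourCandidates {w₁} {w₂} {w₃} {w₄}
                   c₁@(w₁≢a ∷ w₁∉Avoid , _) c₂@(w₂≢a ∷ w₂∉Avoid , _) c₃@(w₃≢a ∷ _ , _) c₄@(w₄≢a ∷ _ , _)
                   w₂≢w₁ w₃≢w₁ w₃≢w₂ w₄≢w₁ w₄≢w₂ w₄≢w₃
      with adj? G w₁ w₃ | adj? G w₁ w₄ | adj? G w₂ w₃ | adj? G w₂ w₄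
    ... | no ¬w₁~w₃ | _ | _ | _ = nonadjacent c₁ c₃ (≢-sym w₃≢w₁) ¬w₁~w₃
    ... | _ | no ¬w₁~w₄ | _ | _ = nonadjacent c₁ c₄ (≢-sym w₄≢w₁) ¬w₁~w₄
    ... | _ | _ | no ¬w₂~w₃ | _ = nonadjacent c₂ c₃ (≢-sym w₃≢w₂) ¬w₂~w₃
    ... | _ | _ | _ | no ¬w₂~w₄ = nonadjacent c₂ c₄ (≢-sym w₄≢w₂) ¬w₂~w₄
    ... | yes w₁~w₃ | yes w₁~w₄ | yes w₂~w₃ | yes w₂~w₄ =
      triple a w₁ w₂ (≢-sym w₁≢a) (≢-sym w₂≢a) (≢-sym w₂≢w₁) (a-cannotForce w₁∉Avoid w₂∉Avoid)
        (twoNbrsOut (w₃ , w₄ , ≢-sym w₄≢w₃ , (w₁~w₃ , w₃∉T) , (w₁~w₄ , w₄∉T)))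
        (twoNbrsOut (w₃ , w₄ , ≢-sym w₄≢w₃ , (w₂~w₃ , w₃∉T) , (w₂~w₄ , w₄∉T)))
      where
      w₃∉T : w₃ ∉ a ∷ w₁ ∷ w₂ ∷ []
      w₃∉T = w₃≢a ∷ w₃≢w₁ ∷ w₃≢w₂ ∷ []
      w₄∉T : w₄ ∉ a ∷ w₁ ∷ w₂ ∷ []
      w₄∉T = w₄≢a ∷ w₄≢w₁ ∷ w₄≢w₂ ∷ []

    go : F≥3
    go with fresh′ (a ∷ Avoid) (room {L = Avoid} short 1)
    ... | w₁ , w₁∉ with fresh′ (w₁ ∷ a ∷ Avoid) (room {L = Avoid} short 2)
    ... | w₂ , w₂≢w₁ ∷ w₂∉ with fresh′ (w₂ ∷ w₁ ∷ a ∷ Avoid) (room {L = Avoid} short 3)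
    ... | w₃ , w₃≢w₂ ∷ w₃≢w₁ ∷ w₃∉ with fresh′ (w₃ ∷ w₂ ∷ w₁ ∷ a ∷ Avoid) (room {L = Avoid} short 4)
    ... | w₄ , w₄≢w₃ ∷ w₄≢w₂ ∷ w₄≢w₁ ∷ w₄∉ =
      candidate w₁∉ λ W₁ → candidate w₂∉ λ W₂ → candidate w₃∉ λ W₃ → candidate w₄∉ λ W₄ →
      fourCandidates (w₁∉ , W₁) (w₂∉ , W₂) (w₃∉ , W₃) (w₄∉ , W₄) w₂≢w₁ w₃≢w₁ w₃≢w₂ w₄≢w₁ w₄≢w₂ w₄≢w₃

  module HighDegree (v : V) (four : Four (v ~_)) where

    v-cannotForce : ∀ x y → CannotForceIn (v ∷ x ∷ y ∷ []) v
    v-cannotForce x y = twoNbrsOut (Two-map (λ (v~c , c∉) → v~c , ≢-sym (~⇒≢ v~c) ∷ c∉) (four⇒two∉ four x y))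

    tripleWithV : ∀ x y → v ≢ x → v ≢ y → x ≢ y → let T = v ∷ x ∷ y ∷ [] in
                  CannotForceIn T x → CannotForceIn T y → F≥3
    tripleWithV x y v≢x v≢y x≢y = triple v x y v≢x v≢y x≢y (v-cannotForce x y)

    cannotForceBeside : Nbrs⊆ x L → y ∉ L → TwoNbrsOutside y (v ∷ []) → CannotForceIn (v ∷ x ∷ y ∷ []) y
    cannotForceBeside nbx y∉L = twoNbrsOut ∘ Two-map
      λ { (y~u , u≢v ∷ []) → y~u , u≢v ∷ nbr≢ nbx y∉L y~u ∷ ≢-sym (~⇒≢ y~u) ∷ [] }

    throughNbr : y ≢ v → t ≢ v → y ~ t → Nbrs⊆ y (t ∷ v ∷ []) →
                 (TwoNbrsOutside t (v ∷ []) → F≥3) → F≥3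
    throughNbr {y} {t} y≢v t≢v y~t nby k with nbrsOutside t (v ∷ [])
    ... | none nbt = ⊥-elim (¬nbr nbt (y≢v ∷ []) (~-sym y~t))
    ... | two+ T = k T
    ... | one _ _ _ nbt with nbt (~-sym y~t)
    ...   | there (here y≡v) = ⊥-elim (y≢v y≡v)
    ...   | here refl = tripleWithV y t (≢-sym y≢v) (≢-sym t≢v) (~⇒≢ y~t)
                          (allNbrsIn nby (3rd ∷ 1st ∷ [])) (allNbrsIn nbt (2nd ∷ 1st ∷ []))

    onlyNbrV : x ≢ v → Nbrs⊆ x (v ∷ []) → F≥3
    onlyNbrV {x} x≢v nbx with fresh (x ∷ v ∷ [])
    ... | y , y≢x ∷ y≢v ∷ [] with nbrsOutside y (v ∷ [])
    ...   | none nby = tripleWithV x y (≢-sym x≢v) (≢-sym y≢v) (≢-sym y≢x)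
                         (allNbrsIn nbx (1st ∷ [])) (allNbrsIn nby (1st ∷ []))
    ...   | two+ Y = tripleWithV x y (≢-sym x≢v) (≢-sym y≢v) (≢-sym y≢x)
                       (allNbrsIn nbx (1st ∷ [])) (cannotForceBeside nbx (y≢v ∷ []) Y)
    ...   | one t (t≢v ∷ []) y~t nby = throughNbr y≢v t≢v y~t nby λ T →
      tripleWithV x t (≢-sym x≢v) (≢-sym t≢v) (≢-sym (nbr≢ nbx (y≢v ∷ []) y~t))
        (allNbrsIn nbx (1st ∷ [])) (cannotForceBeside nbx (t≢v ∷ []) T)

    module Path {x z z′} (x≢v : x ≢ v) (z≢v : z ≢ v) (z′≢v : z′ ≢ v) (z′≢x : z′ ≢ x)
                (x~z : x ~ z) (z~z′ : z ~ z′)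
                (nbx : Nbrs⊆ x (z ∷ v ∷ [])) (nbz : Nbrs⊆ z (z′ ∷ x ∷ v ∷ [])) where

      Far : V → Set
      Far y = y ∉ v ∷ x ∷ z ∷ z′ ∷ []

      pairWithZ : Far y → TwoNbrsOutside y (v ∷ []) → F≥3
      pairWithZ {y} (y≢v ∷ y≢x ∷ y≢z ∷ y≢z′ ∷ []) Y =
        tripleWithV z y (≢-sym z≢v) (≢-sym y≢v) (≢-sym y≢z)
          (twoNbrsOut (x , z′ , ≢-sym z′≢x , (~-sym x~z , x≢v ∷ ~⇒≢ x~z ∷ ≢-sym y≢x ∷ [])
                                          , (z~z′ , z′≢v ∷ ≢-sym (~⇒≢ z~z′) ∷ ≢-sym y≢z′ ∷ [])))
          (cannotForceBeside nbz (y≢z′ ∷ y≢x ∷ y≢v ∷ []) Y)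

      probe : Far y → (y ~ z′ → Nbrs⊆ y (z′ ∷ v ∷ []) → F≥3) → F≥3
      probe {y} far@(y≢v ∷ y≢x ∷ y≢z ∷ y≢z′ ∷ []) atZ′ with nbrsOutside y (v ∷ [])
      ... | none nby = onlyNbrV y≢v nby
      ... | two+ Y = pairWithZ far Y
      ... | one t (t≢v ∷ []) y~t nby with t ≟ z′
      ...   | yes refl = atZ′ y~t nby
      ...   | no t≢z′ = throughNbr y≢v t≢v y~t nby (pairWithZ (t≢v ∷ t≢x ∷ t≢z ∷ t≢z′ ∷ []))
        where
        t≢x : t ≢ x
        t≢x = nbr≢ nbx (y≢z ∷ y≢v ∷ []) y~t
        t≢z : t ≢ z
        t≢z = nbr≢ nbz (y≢z′ ∷ y≢x ∷ y≢v ∷ []) y~t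

      -- Two vertices hanging on z′ give z′ the two white neighbours z and y₂.
      go : F≥3
      go with fresh (v ∷ x ∷ z ∷ z′ ∷ [])
      ... | y₁ , far₁@(y₁≢v ∷ _ ∷ y₁≢z ∷ _) with fresh (y₁ ∷ v ∷ x ∷ z ∷ z′ ∷ [])
      ... | y₂ , y₂≢y₁ ∷ far₂@(y₂≢v ∷ _ ∷ y₂≢z ∷ _) =
        probe far₁ λ y₁~z′ nby₁ → probe far₂ λ y₂~z′ _ →
          tripleWithV y₁ z′ (≢-sym y₁≢v) (≢-sym z′≢v) (~⇒≢ y₁~z′) (allNbrsIn nby₁ (3rd ∷ 1st ∷ []))
            (twoNbrsOut (z , y₂ , ≢-sym y₂≢z , (~-sym z~z′ , z≢v ∷ ≢-sym y₁≢z ∷ ~⇒≢ z~z′ ∷ [])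
                                             , (~-sym y₂~z′ , y₂≢v ∷ y₂≢y₁ ∷ ~⇒≢ y₂~z′ ∷ [])))

    soleOtherNbr : x ≢ v → z ≢ v → x ~ z → Nbrs⊆ x (z ∷ v ∷ []) → F≥3
    soleOtherNbr {x} {z} x≢v z≢v x~z nbx with nbrsOutside z (x ∷ v ∷ [])
    ... | none nbz = tripleWithV x z (≢-sym x≢v) (≢-sym z≢v) (~⇒≢ x~z)
                       (allNbrsIn nbx (3rd ∷ 1st ∷ [])) (allNbrsIn nbz (2nd ∷ 1st ∷ []))
    ... | two+ Z = tripleWithV x z (≢-sym x≢v) (≢-sym z≢v) (~⇒≢ x~z) (allNbrsIn nbx (3rd ∷ 1st ∷ []))
                     (twoNbrsOut (Two-map (λ { (z~u , u≢x ∷ u≢v ∷ []) →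
                       z~u , u≢v ∷ u≢x ∷ ≢-sym (~⇒≢ z~u) ∷ [] }) Z))
    ... | one z′ (z′≢x ∷ z′≢v ∷ []) z~z′ nbz = Path.go x≢v z≢v z′≢v z′≢x x~z z~z′ nbx nbz

    candidate : x ∉ v ∷ [] → (TwoNbrsOutside x (v ∷ []) → F≥3) → F≥3
    candidate {x} (x≢v ∷ []) k with nbrsOutside x (v ∷ [])
    ... | none nbx = onlyNbrV x≢v nbx
    ... | one z (z≢v ∷ []) x~z nbx = soleOtherNbr x≢v z≢v x~z nbx
    ... | two+ X = k X

    go : F≥3
    go = FourCandidates.go v [] z≤n (λ {x} {y} _ _ → v-cannotForce x y) candidate

  module LeafProbe (Far Hub : V → Set)
      (hubOrFar : ∀ {y t} → Far y → y ~ t → Hub t ⊎ Far t)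
      (pairUp : ∀ {y} → Far y → Two (y ~_) → F≥3) where

    probe : Far y → (∀ {t} → Hub t → LeafAt t y → F≥3) → F≥3
    probe {y} far atHub with nbrsOutside y []
    ... | none nby = isolated nby
    ... | two+ Y = pairUp far (Two-map proj₁ Y)
    ... | one t [] y~t nby with hubOrFar far y~t
    ...   | inj₁ hub = atHub hub (y~t , nby)
    ...   | inj₂ far-t with nbrOutside? t (y ∷ [])
    ...     | inj₂ nbt = isolatedEdge nby nbt
    ...     | inj₁ (t′ , t~t′ , t′≢y ∷ []) = pairUp far-t (y , t′ , ≢-sym t′≢y , ~-sym y~t , t~t′)

  module Chain {l p q r s} (l~p : l ~ p) (p~q : p ~ q) (q~r : q ~ r) (r~s : r ~ s)
      (nbl : Nbrs⊆ l (p ∷ [])) (nbp : Nbrs⊆ p (q ∷ l ∷ []))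
      (nbq : Nbrs⊆ q (r ∷ p ∷ [])) (nbr : Nbrs⊆ r (s ∷ q ∷ []))
      (q≢l : q ≢ l) (r≢p : r ≢ p) (s≢q : s ≢ q) where

    r≢l : r ≢ l
    r≢l = nbr≢ nbl (≢-sym (~⇒≢ p~q) ∷ []) q~r

    s≢p : s ≢ p
    s≢p = nbr≢ nbp (≢-sym (~⇒≢ q~r) ∷ r≢l ∷ []) r~s

    Far : V → Set
    Far y = y ∉ l ∷ p ∷ q ∷ r ∷ s ∷ []

    hubOrFar : Far y → y ~ t → t ≡ s ⊎ Far t
    hubOrFar {t = t} (y≢l ∷ y≢p ∷ y≢q ∷ y≢r ∷ y≢s ∷ []) y~t with t ≟ s
    ... | yes t≡s = inj₁ t≡s
    ... | no t≢s = inj₂ (nbr≢ nbl (y≢p ∷ []) y~t ∷ nbr≢ nbp (y≢q ∷ y≢l ∷ []) y~t ∷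
                         nbr≢ nbq (y≢r ∷ y≢p ∷ []) y~t ∷ nbr≢ nbr (y≢s ∷ y≢q ∷ []) y~t ∷ t≢s ∷ [])

    pairUp : Far y → Two (y ~_) → F≥3
    pairUp (y≢l ∷ y≢p ∷ y≢q ∷ y≢r ∷ y≢s ∷ []) Y =
      triple _ _ _ (≢-sym r≢p) (≢-sym y≢p) (≢-sym y≢r)
        (twoNbrsOut (q , l , q≢l , (p~q , ≢-sym (~⇒≢ p~q) ∷ ~⇒≢ q~r ∷ ≢-sym y≢q ∷ [])
                                 , (~-sym l~p , ~⇒≢ l~p ∷ ≢-sym r≢l ∷ ≢-sym y≢l ∷ [])))
        (twoNbrsOut (q , s , ≢-sym s≢q , (~-sym q~r , ≢-sym (~⇒≢ p~q) ∷ ~⇒≢ q~r ∷ ≢-sym y≢q ∷ [])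
                                       , (r~s , s≢p ∷ ≢-sym (~⇒≢ r~s) ∷ ≢-sym y≢s ∷ [])))
        (twoNbrsOut (Two-map (λ y~c → y~c , nbr≢ nbp (y≢q ∷ y≢l ∷ []) y~c ∷ nbr≢ nbr (y≢s ∷ y≢q ∷ []) y~c ∷
                                            ≢-sym (~⇒≢ y~c) ∷ []) Y))

    go : F≥3
    go with fresh (l ∷ p ∷ q ∷ r ∷ s ∷ [])
    ... | y₁ , far₁ with fresh (y₁ ∷ l ∷ p ∷ q ∷ r ∷ s ∷ [])
    ... | y₂ , y₂≢y₁ ∷ far₂ =
      probe far₁ λ { refl L₁ → probe far₂ λ { refl L₂ → twinLeaves (≢-sym y₂≢y₁) L₁ L₂ } }
      where open LeafProbe Far (_≡ s) hubOrFar pairUp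

  leafPath : l ~ p → p ~ q → q ≢ l → Nbrs⊆ l (p ∷ []) → Nbrs⊆ p (q ∷ l ∷ []) → F≥3
  leafPath {l} {p} {q} l~p p~q q≢l nbl nbp with nbrsOutside q (p ∷ [])
  ... | none nbq = triple l p q (~⇒≢ l~p) (≢-sym q≢l) (~⇒≢ p~q)
                     (allNbrsIn nbl (2nd ∷ [])) (allNbrsIn nbp (3rd ∷ 1st ∷ [])) (allNbrsIn nbq (2nd ∷ []))
  ... | two+ Q = triple l p q (~⇒≢ l~p) (≢-sym q≢l) (~⇒≢ p~q)
                   (allNbrsIn nbl (2nd ∷ [])) (allNbrsIn nbp (3rd ∷ 1st ∷ []))
                   (twoNbrsOut (Two-map (λ { (q~u , u≢p ∷ []) →
                     q~u , nbr≢ nbl (≢-sym (~⇒≢ p~q) ∷ []) q~u ∷ u≢p ∷ ≢-sym (~⇒≢ q~u) ∷ [] }) Q))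
  ... | one r (r≢p ∷ []) q~r nbq with nbrsOutside r (q ∷ []) | nbr≢ nbl (≢-sym (~⇒≢ p~q) ∷ []) q~r
  ...   | none nbr | r≢l =
    quadruple l p q r (~⇒≢ l~p) (≢-sym q≢l) (≢-sym r≢l) (~⇒≢ p~q) (≢-sym r≢p) (~⇒≢ q~r)
      (allNbrsIn nbl (2nd ∷ [])) (allNbrsIn nbp (3rd ∷ 1st ∷ []))
      (allNbrsIn nbq (4th ∷ 2nd ∷ [])) (allNbrsIn nbr (3rd ∷ []))
  ...   | two+ R | r≢l =
    quadruple l p q r (~⇒≢ l~p) (≢-sym q≢l) (≢-sym r≢l) (~⇒≢ p~q) (≢-sym r≢p) (~⇒≢ q~r)
      (allNbrsIn nbl (2nd ∷ [])) (allNbrsIn nbp (3rd ∷ 1st ∷ [])) (allNbrsIn nbq (4th ∷ 2nd ∷ []))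
      (twoNbrsOut (Two-map (λ { (r~u , u≢q ∷ []) →
        r~u , nbr≢ nbl (r≢p ∷ []) r~u ∷ nbr≢ nbp (≢-sym (~⇒≢ q~r) ∷ r≢l ∷ []) r~u ∷ u≢q ∷ ≢-sym (~⇒≢ r~u) ∷ []
      }) R))
  ...   | one s (s≢q ∷ []) r~s nbr | _ = Chain.go l~p p~q q~r r~s nbl nbp nbq nbr q≢l r≢p s≢q

  module LeafFork {l p q₁ q₂} (l~p : l ~ p) (p~q₁ : p ~ q₁) (p~q₂ : p ~ q₂)
      (q₁≢q₂ : q₁ ≢ q₂) (q₁≢l : q₁ ≢ l) (q₂≢l : q₂ ≢ l)
      (nbl : Nbrs⊆ l (p ∷ [])) (nbp : Nbrs⊆ p (q₁ ∷ q₂ ∷ l ∷ [])) where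

    Far : V → Set
    Far y = y ∉ l ∷ p ∷ q₁ ∷ q₂ ∷ []

    Hub : V → Set
    Hub t = t ≡ q₁ ⊎ t ≡ q₂

    hubOrFar : Far y → y ~ t → Hub t ⊎ Far t
    hubOrFar {t = t} (y≢l ∷ y≢p ∷ y≢q₁ ∷ y≢q₂ ∷ []) y~t with t ≟ q₁ | t ≟ q₂
    ... | yes t≡q₁ | _ = inj₁ (inj₁ t≡q₁)
    ... | _ | yes t≡q₂ = inj₁ (inj₂ t≡q₂)
    ... | no t≢q₁ | no t≢q₂ =
      inj₂ (nbr≢ nbl (y≢p ∷ []) y~t ∷ nbr≢ nbp (y≢q₁ ∷ y≢q₂ ∷ y≢l ∷ []) y~t ∷ t≢q₁ ∷ t≢q₂ ∷ [])

    pairUp : Far y → Two (y ~_) → F≥3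
    pairUp (y≢l ∷ y≢p ∷ y≢q₁ ∷ y≢q₂ ∷ []) Y =
      triple _ _ _ (~⇒≢ l~p) (≢-sym y≢l) (≢-sym y≢p) (allNbrsIn nbl (2nd ∷ []))
        (twoNbrsOut (q₁ , q₂ , q₁≢q₂ , (p~q₁ , q₁≢l ∷ ≢-sym (~⇒≢ p~q₁) ∷ ≢-sym y≢q₁ ∷ [])
                                     , (p~q₂ , q₂≢l ∷ ≢-sym (~⇒≢ p~q₂) ∷ ≢-sym y≢q₂ ∷ [])))
        (twoNbrsOut (Two-map (λ y~c → y~c , nbr≢ nbl (y≢p ∷ []) y~c ∷ nbr≢ nbp (y≢q₁ ∷ y≢q₂ ∷ y≢l ∷ []) y~c ∷
                                            ≢-sym (~⇒≢ y~c) ∷ []) Y))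

    twoShareHub : y₁ ≢ y₂ → y₁ ≢ y₃ → y₂ ≢ y₃ →
                  Hub t₁ → LeafAt t₁ y₁ → Hub t₂ → LeafAt t₂ y₂ → Hub t₃ → LeafAt t₃ y₃ → F≥3
    twoShareHub y₁≢y₂ _ _ (inj₁ refl) L₁ (inj₁ refl) L₂ _ _ = twinLeaves y₁≢y₂ L₁ L₂
    twoShareHub y₁≢y₂ _ _ (inj₂ refl) L₁ (inj₂ refl) L₂ _ _ = twinLeaves y₁≢y₂ L₁ L₂
    twoShareHub _ y₁≢y₃ _ (inj₁ refl) L₁ _ _ (inj₁ refl) L₃ = twinLeaves y₁≢y₃ L₁ L₃
    twoShareHub _ y₁≢y₃ _ (inj₂ refl) L₁ _ _ (inj₂ refl) L₃ = twinLeaves y₁≢y₃ L₁ L₃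
    twoShareHub _ _ y₂≢y₃ _ _ (inj₁ refl) L₂ (inj₁ refl) L₃ = twinLeaves y₂≢y₃ L₂ L₃
    twoShareHub _ _ y₂≢y₃ _ _ (inj₂ refl) L₂ (inj₂ refl) L₃ = twinLeaves y₂≢y₃ L₂ L₃

    go : F≥3
    go with fresh (l ∷ p ∷ q₁ ∷ q₂ ∷ [])
    ... | y₁ , far₁ with fresh (y₁ ∷ l ∷ p ∷ q₁ ∷ q₂ ∷ [])
    ... | y₂ , y₂≢y₁ ∷ far₂ with fresh (y₂ ∷ y₁ ∷ l ∷ p ∷ q₁ ∷ q₂ ∷ [])
    ... | y₃ , y₃≢y₂ ∷ y₃≢y₁ ∷ far₃ =
      probe far₁ λ h₁ L₁ → probe far₂ λ h₂ L₂ → probe far₃ λ h₃ L₃ →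
      twoShareHub (≢-sym y₂≢y₁) (≢-sym y₃≢y₁) (≢-sym y₃≢y₂) h₁ L₁ h₂ L₂ h₃ L₃
      where open LeafProbe Far Hub hubOrFar pairUp

  leaf : l ~ p → Nbrs⊆ l (p ∷ []) → F≥3
  leaf {l} {p} l~p nbl with nbrsOutside⁺ p (l ∷ [])
  ... | none nbp = isolatedEdge nbl nbp
  ... | one q (q≢l ∷ []) p~q nbp = leafPath l~p p~q q≢l nbl nbp
  ... | two q₁ q₂ q₁≢q₂ (q₁≢l ∷ []) (q₂≢l ∷ []) p~q₁ p~q₂ nbp =
    LeafFork.go l~p p~q₁ p~q₂ q₁≢q₂ q₁≢l q₂≢l nbl nbp
  ... | three+ (q₁ , q₂ , q₃ , (q₁≢q₂ , q₁≢q₃ , q₂≢q₃) ,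
                (p~q₁ , q₁≢l ∷ []) , (p~q₂ , q₂≢l ∷ []) , (p~q₃ , q₃≢l ∷ [])) =
    HighDegree.go p (l , q₁ , q₂ , q₃ , (≢-sym q₁≢l , ≢-sym q₂≢l , ≢-sym q₃≢l , q₁≢q₂ , q₁≢q₃ , q₂≢q₃) ,
                     ~-sym l~p , p~q₁ , p~q₂ , p~q₃)

  degree2 : a ~ b₁ → a ~ b₂ → b₁ ≢ b₂ → Nbrs⊆ a (b₁ ∷ b₂ ∷ []) → F≥3
  degree2 {a} {b₁} {b₂} a~b₁ a~b₂ b₁≢b₂ nba =
    FourCandidates.go a (b₁ ∷ b₂ ∷ []) (s≤s (s≤s z≤n)) a-cannotForce candidate
    where
    a-cannotForce : x ∉ b₁ ∷ b₂ ∷ [] → y ∉ b₁ ∷ b₂ ∷ [] → CannotForceIn (a ∷ x ∷ y ∷ []) a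
    a-cannotForce (x≢b₁ ∷ x≢b₂ ∷ []) (y≢b₁ ∷ y≢b₂ ∷ []) =
      twoNbrsOut (b₁ , b₂ , b₁≢b₂ , (a~b₁ , ≢-sym (~⇒≢ a~b₁) ∷ ≢-sym x≢b₁ ∷ ≢-sym y≢b₁ ∷ [])
                                  , (a~b₂ , ≢-sym (~⇒≢ a~b₂) ∷ ≢-sym x≢b₂ ∷ ≢-sym y≢b₂ ∷ []))

    candidate : x ∉ a ∷ b₁ ∷ b₂ ∷ [] → (TwoNbrsOutside x (a ∷ []) → F≥3) → F≥3
    candidate {x} (_ ∷ x∉b) k with nbrsOutside x []
    ... | none nbx = isolated nbx
    ... | one _ _ x~t nbx = leaf x~t nbx
    ... | two+ X = k (Two-map (λ { (x~u , []) → x~u , nbr≢ nba x∉b x~u ∷ [] }) X)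

  degree3 : a ~ b₁ → a ~ b₂ → b₁ ≢ b₂ → Nbrs⊆ a (b₁ ∷ b₂ ∷ b₃ ∷ []) → F≥3
  degree3 {a} {b₁} {b₂} {b₃} a~b₁ a~b₂ b₁≢b₂ nba with fresh (a ∷ b₁ ∷ b₂ ∷ b₃ ∷ [])
  ... | y₁ , y₁≢a ∷ y₁∉b@(y₁≢b₁ ∷ y₁≢b₂ ∷ _) with fresh (y₁ ∷ a ∷ b₁ ∷ b₂ ∷ b₃ ∷ [])
  ... | y₂ , y₂≢y₁ ∷ y₂≢a ∷ y₂∉b@(y₂≢b₁ ∷ y₂≢b₂ ∷ _) =
    probe y₁ λ Y₁ → probe y₂ λ Y₂ →
      triple a y₁ y₂ (≢-sym y₁≢a) (≢-sym y₂≢a) (≢-sym y₂≢y₁)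
        (twoNbrsOut (b₁ , b₂ , b₁≢b₂ , (a~b₁ , ≢-sym (~⇒≢ a~b₁) ∷ ≢-sym y₁≢b₁ ∷ ≢-sym y₂≢b₁ ∷ [])
                                    , (a~b₂ , ≢-sym (~⇒≢ a~b₂) ∷ ≢-sym y₁≢b₂ ∷ ≢-sym y₂≢b₂ ∷ [])))
        (twoNbrsOut (Two-map (λ ((y₁~c , _) , c≢y₂) → y₁~c , nbr≢ nba y₁∉b y₁~c ∷ ≢-sym (~⇒≢ y₁~c) ∷ c≢y₂ ∷ [])
                             (three⇒two≢ Y₁ y₂)))
        (twoNbrsOut (Two-map (λ ((y₂~c , _) , c≢y₁) → y₂~c , nbr≢ nba y₂∉b y₂~c ∷ c≢y₁ ∷ ≢-sym (~⇒≢ y₂~c) ∷ [])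
                             (three⇒two≢ Y₂ y₁)))
    where
    probe : ∀ y → (Three (λ t → y ~ t × t ∉ []) → F≥3) → F≥3
    probe y k with nbrsOutside⁺ y []
    ... | none nby = isolated nby
    ... | one _ _ y~t nby = leaf y~t nby
    ... | two _ _ t₁≢t₂ _ _ y~t₁ y~t₂ nby = degree2 y~t₁ y~t₂ t₁≢t₂ nby
    ... | three+ Y = k Y

  byDegree : V → F≥3
  byDegree w with nbrsOutside⁺ w []
  ... | none nbw = isolated nbw
  ... | one _ _ w~t nbw = leaf w~t nbw
  ... | two _ _ t₁≢t₂ _ _ w~t₁ w~t₂ nbw = degree2 w~t₁ w~t₂ t₁≢t₂ nbw
  ... | three+ (b₁ , b₂ , b₃ , (b₁≢b₂ , b₁≢b₃ , b₂≢b₃) , (w~b₁ , _) , (w~b₂ , _) , (w~b₃ , _))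
      with nbrOutside? w (b₁ ∷ b₂ ∷ b₃ ∷ [])
  ...   | inj₂ nbw = degree3 w~b₁ w~b₂ b₁≢b₂ nbw
  ...   | inj₁ (t , w~t , t≢b₁ ∷ t≢b₂ ∷ t≢b₃ ∷ []) =
    HighDegree.go w (b₁ , b₂ , b₃ , t , (b₁≢b₂ , b₁≢b₃ , ≢-sym t≢b₁ , b₂≢b₃ , ≢-sym t≢b₂ , ≢-sym t≢b₃) ,
                     w~b₁ , w~b₂ , w~b₃ , w~t)

theorem2p1 : (n : ℕ) → 7 ≤ n → (G : Graph n) → FailedZFNumber≥ G 3
theorem2p1 n 7≤n G = Casework.byDegree G 7≤n (fromℕ< (≤-trans (s≤s z≤n) 7≤n))
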